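{- Let $w,u\in S_n$ with $u\le w$, let $\mathbf{w}=s_{i_1}\cdots s_{i_m}$ be a reduced word for $w$, and let $J\subseteq[m]$ be the set of positions of the positive distinguished subexpression for $u$ in $\mathbf{w}$. Let $j_1<j_2<\dots<j_d$ be the elements of $[m]\setminus J$, and for $0\le r\le d$ let $\mathbf{v}$ be the subword of $\mathbf{w}$ consisting of the letters at positions $J\cup\{j_{d-r+1},\dots,j_d\}$ (i.e. the letters of the PDS together with the $r$ rightmost non-PDS letters, which correspond to the $r$ leftmost bridges of the bridge diagram). Then $\mathbf{v}$ is a reduced word for some $v\in S_n$, and the letters of $\mathbf{v}$ coming from positions in $J$ form the positive distinguished subexpression for $u$ in $\mathbf{v}$.
   Context: For a reduced word $\mathbf{w}=s_{i_1}\cdots s_{i_m}$ and $J\subseteq[m]$, let $u_{(j)}$ be the ordered product of the letters $s_{i_p}$ with $p\in J$, $p\le j$ ($u_{(0)}=1$). $J$ is a positive distinguished subexpression (PDS) for $u=u_{(m)}$ if for all $j$: $u_{(j)}\le u_{(j-1)}s_{i_j}$ and $u_{(j-1)}<u_{(j-1)}s_{i_j}$ (Bruhat order). For $u\le w$ the PDS for $u$ in $\mathbf{w}$ exists and is unique. In the associated bridge diagram, letters are drawn right to left (the leftmost letter of the word is the rightmost crossing/bridge), letters in $J$ drawn as crossings and letters not in $J$ as bridges. -}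

module Defs where

open import Data.Nat using (ℕ; zero; suc; _≤_; _<_)
open import Data.Fin using (Fin; inject₁) renaming (suc to fsuc)
open import Data.Fin.Permutation as P using (Permutation′; transpose; _⟨$⟩ʳ_; _∘ₚ_)
open import Data.List using (List; []; _∷_; length)
open import Data.Bool using (Bool; true; false; if_then_else_)
open import Data.Product using (Σ; _×_; _,_; ∃-syntax; proj₁)
open import Data.Unit using (⊤)
open import Data.Empty using (⊥)
open import Relation.Binary.PropositionalEquality using (_≡_; _≢_)
open import Relation.Nullary using (¬_)

-- The symmetric group S_{n+1} on Fin (suc n); its simple transpositions
-- s_i (i : Fin n) swap i and i+1 (0-based).

S : ℕ → Set
S n = Permutation′ (suc n)

_≈_ : ∀ {n} → S n → S n → Set
_≈_ = P._≈_

-- group product, as composition of functions: (π · ρ)(i) = π (ρ i)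
_·_ : ∀ {n} → S n → S n → S n
π · ρ = ρ ∘ₚ π

e : ∀ {n} → S n
e = P.id

s : ∀ {n} → Fin n → S n
s i = transpose (inject₁ i) (fsuc i)

Word : ℕ → Set
Word n = List (Fin n)

prod : ∀ {n} → Word n → S n
prod []       = e
prod (i ∷ ws) = s i · prod ws

HasLength : ∀ {n} → S n → ℕ → Set
HasLength {n} w k =
  (Σ (Word n) λ ws → (prod ws ≈ w) × (length ws ≡ k))
  × (∀ (ws : Word n) → prod ws ≈ w → k ≤ length ws)

Reduced : ∀ {n} → Word n → Set
Reduced {n} ws = ∀ (ws′ : Word n) → prod ws′ ≈ prod ws → length ws ≤ length ws′

LengthLess : ∀ {n} → S n → S n → Set
LengthLess x y = ∃[ k ] ∃[ k′ ] (HasLength x k × HasLength y k′ × k < k′)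

data _≤B_ {n} : S n → S n → Set where
  ≤B-refl : ∀ {u v} → u ≈ v → u ≤B v
  ≤B-step : ∀ {u x y} (a b : Fin (suc n)) → a ≢ b →
            u ≤B x → LengthLess x (x · transpose a b) →
            (x · transpose a b) ≈ y → u ≤B y

_<B_ : ∀ {n} → S n → S n → Set
u <B v = u ≤B v × ¬ (u ≈ v)

-- Subexpressions. A subset J ⊆ [m] of positions of a word of length m is
-- a list of m booleans (true = position in J).

PDS-from : ∀ {n} → S n → Word n → List Bool → S n → Set
PDS-from x []       []       u = x ≈ u
PDS-from x []       (_ ∷ _)  u = ⊥
PDS-from x (_ ∷ _)  []       u = ⊥
PDS-from x (i ∷ ws) (b ∷ bs) u =
  let x′ = if b then x · s i else x in
  (x′ ≤B (x · s i)) × (x <B (x · s i)) × PDS-from x′ ws bs u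

IsPDS : ∀ {n} → Word n → List Bool → S n → Set
IsPDS ws J u = PDS-from e ws J u

countFalse : List Bool → ℕ
countFalse []          = 0
countFalse (true ∷ bs)  = countFalse bs
countFalse (false ∷ bs) = suc (countFalse bs)

-- addRightmost r J : the set J ∪ {the r rightmost positions not in J}
-- (computed from the right; the second component is the number of
-- positions still to be added)
addRightmost′ : ℕ → List Bool → List Bool × ℕ
addRightmost′ r [] = [] , r
addRightmost′ r (b ∷ bs) with addRightmost′ r bs
... | bs′ , k with b
...   | true  = true ∷ bs′ , k
...   | false with k
...     | zero  = false ∷ bs′ , zero
...     | suc k′ = true ∷ bs′ , k′

addRightmost : ℕ → List Bool → List Bool
addRightmost r bs = proj₁ (addRightmost′ r bs)

select : ∀ {A : Set} → List A → List Bool → List A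
select []       _            = []
select (_ ∷ _)  []           = []
select (x ∷ xs) (true ∷ ks)  = x ∷ select xs ks
select (x ∷ xs) (false ∷ ks) = select xs ks

-- The length of a permutation is its number of inversions, and a
-- word W "ascends" from y (Asc y W) when each letter raises the length by
-- one; W is reduced iff it ascends from the identity.  The PDS condition
-- u_(j-1) < u_(j-1) s_{i_j} says each letter is an ascent of the running
-- product.  The key lemma (Asc-shift) states: if a reduced Z ascends from
-- x and from s_i, and i is an ascent of x, then Z ascends from x s_i.  It
-- is proved through the inversion-set criterion: Z ascends from y iff y
-- keeps in order every pair of values inverted by prod Z.  With it, the
-- rest of w ascends from every intermediate product u_(j-1) (PDS⇒Asc).
-- The selected subword v consists of letters of J (ascents by the PDS
-- condition) followed, from the first added position on, by a whole tail
-- of w, so v ascends from the identity and is reduced.  Finally, a PDS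
-- restricts to any larger set of positions, since skipped letters never
-- change the running product.

module Submission where

open import Defs
open import Data.Nat using (ℕ; zero; suc; pred; _≤_; _<_; _+_; _∸_; z≤n; s≤s; _<?_; _≤?_)
open import Data.Nat.Properties
open import Algebra.Properties.CommutativeSemigroup +-commutativeSemigroup using (x∙yz≈y∙xz)
open import Data.Fin using (Fin; toℕ; inject₁; lower₁) renaming (zero to fzero; suc to fsuc)
import Data.Fin.Properties as FP
open import Data.Fin.Permutation as P using (transpose; _⟨$⟩ʳ_; _⟨$⟩ˡ_)
open import Data.List using (List; []; _∷_; length; _++_; tabulate; _∷ʳ_; replicate)
open import Data.List.Reverse using (Reverse; []; _∶_∶ʳ_; reverseView)
import Data.List.Properties as LP
open import Data.Bool using (Bool; true; false)
open import Data.Product using (Σ; _×_; _,_; proj₂; map₁; ∃-syntax)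
open import Data.Sum using (_⊎_; inj₁; inj₂)
open import Data.Unit using (⊤; tt)
open import Data.Empty using (⊥; ⊥-elim)
open import Relation.Nullary using (¬_; yes; no)
open import Relation.Nullary.Decidable using (dec-true; dec-false; _×-dec_)
open import Relation.Binary.Definitions using (tri<; tri≈; tri>)
open import Relation.Binary.PropositionalEquality

val : ∀ {n} → S n → Fin (suc n) → ℕ
val y k = toℕ (y ⟨$⟩ʳ k)

Ascent Descent : ∀ {n} → S n → Fin n → Set
Ascent  y b = val y (inject₁ b) < val y (fsuc b)
Descent y b = val y (fsuc b) < val y (inject₁ b)

data SwapView {n} (b : Fin n) : Fin (suc n) → Set where
  at-b   : SwapView b (inject₁ b)
  at-b+1 : SwapView b (fsuc b)
  fixed  : ∀ {k} → k ≢ inject₁ b → k ≢ fsuc b → SwapView b k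

swapView : ∀ {n} (b : Fin n) k → SwapView b k
swapView b k with k FP.≟ inject₁ b | k FP.≟ fsuc b
... | yes refl | _         = at-b
... | no _     | yes refl  = at-b+1
... | no k≢b   | no k≢b+1  = fixed k≢b k≢b+1

module _ {n : ℕ} (b : Fin n) where

  s-b : s b ⟨$⟩ʳ inject₁ b ≡ fsuc b
  s-b rewrite dec-true (inject₁ b FP.≟ inject₁ b) refl = refl

  s-b+1 : s b ⟨$⟩ʳ fsuc b ≡ inject₁ b
  s-b+1 with fsuc b FP.≟ inject₁ b
  ... | yes b+1≡b = b+1≡b
  ... | no _ rewrite dec-true (fsuc b FP.≟ fsuc b) refl = refl

  s-fixed : ∀ {k} → k ≢ inject₁ b → k ≢ fsuc b → s b ⟨$⟩ʳ k ≡ k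
  s-fixed {k} k≢b k≢b+1
    rewrite dec-false (k FP.≟ inject₁ b) k≢b | dec-false (k FP.≟ fsuc b) k≢b+1 = refl

  s-involutive : ∀ k → s b ⟨$⟩ʳ (s b ⟨$⟩ʳ k) ≡ k
  s-involutive k with swapView b k
  ... | at-b rewrite s-b = s-b+1
  ... | at-b+1 rewrite s-b+1 = s-b
  ... | fixed k≢b k≢b+1 rewrite s-fixed k≢b k≢b+1 = s-fixed k≢b k≢b+1

  b<b+1 : toℕ (inject₁ b) < toℕ (fsuc b)
  b<b+1 = s≤s (≤-reflexive (FP.toℕ-inject₁ b))

  above-b+1 : ∀ {q} → toℕ (inject₁ b) < toℕ q → q ≢ fsuc b → toℕ (fsuc b) < toℕ q
  above-b+1 b<q q≢b+1 =
    ≤∧≢⇒< (subst (λ m → suc m ≤ _) (FP.toℕ-inject₁ b) b<q) (λ eq → q≢b+1 (FP.toℕ-injective (sym eq)))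

  below-b : ∀ {p} → toℕ p < toℕ (fsuc b) → p ≢ inject₁ b → toℕ p < toℕ (inject₁ b)
  below-b p<b+1 p≢b =
    ≤∧≢⇒< (subst (_ ≤_) (sym (FP.toℕ-inject₁ b)) (m<1+n⇒m≤n p<b+1)) (λ eq → p≢b (FP.toℕ-injective eq))

  s-monotone : ∀ {k l} → toℕ k < toℕ l → ¬ (k ≡ inject₁ b × l ≡ fsuc b) →
               toℕ (s b ⟨$⟩ʳ k) < toℕ (s b ⟨$⟩ʳ l)
  s-monotone {k} {l} k<l not-pair with swapView b k | swapView b l
  ... | at-b      | at-b      = ⊥-elim (<-irrefl refl k<l)
  ... | at-b      | at-b+1    = ⊥-elim (not-pair (refl , refl))
  ... | at-b      | fixed p q rewrite s-b | s-fixed p q = above-b+1 k<l q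
  ... | at-b+1    | at-b      = ⊥-elim (<-asym k<l b<b+1)
  ... | at-b+1    | at-b+1    = ⊥-elim (<-irrefl refl k<l)
  ... | at-b+1    | fixed p q rewrite s-b+1 | s-fixed p q = <-trans b<b+1 k<l
  ... | fixed p q | at-b      rewrite s-fixed p q | s-b = <-trans k<l b<b+1
  ... | fixed p q | at-b+1    rewrite s-fixed p q | s-b+1 = below-b k<l p
  ... | fixed p q | fixed p′ q′ rewrite s-fixed p q | s-fixed p′ q′ = k<l

below : ℕ → ℕ → ℕ
below c a with c <? a
... | yes _ = 1
... | no _  = 0

below-yes : ∀ {c a} → c < a → below c a ≡ 1
below-yes {c} {a} c<a with c <? a
... | yes _   = refl
... | no c≮a = ⊥-elim (c≮a c<a)

below-no : ∀ {c a} → ¬ c < a → below c a ≡ 0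
below-no {c} {a} c≮a with c <? a
... | yes c<a = ⊥-elim (c≮a c<a)
... | no _    = refl

countBelow : ℕ → List ℕ → ℕ
countBelow a []       = 0
countBelow a (c ∷ cs) = below c a + countBelow a cs

inversions : List ℕ → ℕ
inversions []       = 0
inversions (a ∷ as) = countBelow a as + inversions as

swapAt : ℕ → List ℕ → List ℕ
swapAt zero    (x ∷ y ∷ r) = y ∷ x ∷ r
swapAt (suc k) (x ∷ r)     = x ∷ swapAt k r
swapAt _       xs          = xs

AscentAt : ℕ → List ℕ → Set
AscentAt zero    (x ∷ y ∷ r) = x < y
AscentAt (suc k) (x ∷ r)     = AscentAt k r
AscentAt _       _           = ⊥

countBelow-swapAt : ∀ a k xs → countBelow a (swapAt k xs) ≡ countBelow a xs
countBelow-swapAt a zero    []          = refl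
countBelow-swapAt a zero    (x ∷ [])    = refl
countBelow-swapAt a zero    (x ∷ y ∷ r) = x∙yz≈y∙xz (below y a) (below x a) (countBelow a r)
countBelow-swapAt a (suc k) []          = refl
countBelow-swapAt a (suc k) (x ∷ r)     = cong (below x a +_) (countBelow-swapAt a k r)

inversions-swapAt : ∀ k xs → AscentAt k xs → inversions (swapAt k xs) ≡ suc (inversions xs)
inversions-swapAt zero (x ∷ y ∷ r) x<y rewrite below-yes x<y | below-no (<-asym x<y) =
  cong suc (x∙yz≈y∙xz (countBelow y r) (countBelow x r) (inversions r))
inversions-swapAt (suc k) (x ∷ r) ascent
  rewrite countBelow-swapAt x k r | inversions-swapAt k r ascent = +-suc (countBelow x r) (inversions r)

countBelow-none : ∀ {m} a (g : Fin m → ℕ) → (∀ k → a < g k) → countBelow a (tabulate g) ≡ 0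
countBelow-none {zero}  a g a<g = refl
countBelow-none {suc m} a g a<g rewrite below-no (<-asym (a<g fzero)) =
  countBelow-none a (λ k → g (fsuc k)) (λ k → a<g (fsuc k))

inversions-increasing : ∀ {m} (g : Fin m → ℕ) → (∀ i j → toℕ i < toℕ j → g i < g j) →
                        inversions (tabulate g) ≡ 0
inversions-increasing {zero}  g increasing = refl
inversions-increasing {suc m} g increasing
  rewrite countBelow-none (g fzero) (λ k → g (fsuc k)) (λ k → increasing fzero (fsuc k) (s≤s z≤n)) =
  inversions-increasing (λ k → g (fsuc k)) (λ i j i<j → increasing (fsuc i) (fsuc j) (s≤s i<j))

tabulate-s : ∀ {m} (f : Fin (suc m) → ℕ) (b : Fin m) →
             tabulate (λ k → f (s b ⟨$⟩ʳ k)) ≡ swapAt (toℕ b) (tabulate f)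
tabulate-s {suc m} f fzero    = refl
tabulate-s {suc m} f (fsuc b) =
  cong (f fzero ∷_) (trans (LP.tabulate-cong (λ k → cong f (P.lift₀-transpose (inject₁ b) (fsuc b) (fsuc k))))
                           (tabulate-s (λ k → f (fsuc k)) b))

tabulate-ascent : ∀ {m} (f : Fin (suc m) → ℕ) (b : Fin m) →
                  f (inject₁ b) < f (fsuc b) → AscentAt (toℕ b) (tabulate f)
tabulate-ascent {suc m} f fzero    ascent = ascent
tabulate-ascent {suc m} f (fsuc b) ascent = tabulate-ascent (λ k → f (fsuc k)) b ascent

-- The inversion number of a permutation (of its one-line notation);
-- it will turn out to be the Coxeter length.
inv : ∀ {n} → S n → ℕ
inv y = inversions (tabulate (val y))

inv-cong : ∀ {n} {y y′ : S n} → y ≈ y′ → inv y ≡ inv y′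
inv-cong y≈y′ = cong inversions (LP.tabulate-cong (λ k → cong toℕ (y≈y′ k)))

inv-e : ∀ {n} → inv (e {n}) ≡ 0
inv-e {n} = inversions-increasing {suc n} toℕ (λ i j i<j → i<j)

inv-ascent : ∀ {n} (y : S n) b → Ascent y b → inv (y · s b) ≡ suc (inv y)
inv-ascent y b ascent = trans (cong inversions (tabulate-s (val y) b))
                               (inversions-swapAt (toℕ b) _ (tabulate-ascent (val y) b ascent))

val-injective : ∀ {n} (y : S n) {k k′} → val y k ≡ val y k′ → k ≡ k′
val-injective y eq =
  trans (sym (P.inverseˡ y)) (trans (cong (y ⟨$⟩ˡ_) (FP.toℕ-injective eq)) (P.inverseˡ y))

ascent-or-descent : ∀ {n} (y : S n) b → Ascent y b ⊎ Descent y b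
ascent-or-descent y b with <-cmp (val y (inject₁ b)) (val y (fsuc b))
... | tri< ascent _ _  = inj₁ ascent
... | tri> _ _ descent = inj₂ descent
... | tri≈ _ eq _      = ⊥-elim (<-irrefl (cong toℕ (val-injective y eq)) (b<b+1 b))

inv-descent : ∀ {n} (y : S n) b → Descent y b → inv y ≡ suc (inv (y · s b))
inv-descent y b descent = begin
  inv y                 ≡⟨ inv-cong {y = y} {y′ = (y · s b) · s b} y≈ysbsb ⟩
  inv ((y · s b) · s b) ≡⟨ inv-ascent (y · s b) b ascent ⟩
  suc (inv (y · s b))   ∎
  where
  open ≡-Reasoning
  y≈ysbsb : y ≈ ((y · s b) · s b)
  y≈ysbsb k = cong (y ⟨$⟩ʳ_) (sym (s-involutive b k))
  ascent : Ascent (y · s b) b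
  ascent = subst₂ _<_ (cong (val y) (sym (s-b b))) (cong (val y) (sym (s-b+1 b))) descent

inv-step : ∀ {n} (y : S n) b → inv (y · s b) ≤ suc (inv y)
inv-step y b with ascent-or-descent y b
... | inj₁ ascent  = ≤-reflexive (inv-ascent y b ascent)
... | inj₂ descent = begin
  inv (y · s b)       ≤⟨ n≤1+n _ ⟩
  suc (inv (y · s b)) ≡⟨ sym (inv-descent y b descent) ⟩
  inv y               ≤⟨ n≤1+n _ ⟩
  suc (inv y)         ∎
  where open ≤-Reasoning

inv-prod-≤ : ∀ {n} (y : S n) W → inv (y · prod W) ≤ inv y + length W
inv-prod-≤ y []      = ≤-reflexive (sym (+-identityʳ _))
inv-prod-≤ y (b ∷ W) = begin
  inv ((y · s b) · prod W) ≤⟨ inv-prod-≤ (y · s b) W ⟩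
  inv (y · s b) + length W ≤⟨ +-monoˡ-≤ (length W) (inv-step y b) ⟩
  suc (inv y) + length W   ≡⟨ sym (+-suc (inv y) (length W)) ⟩
  inv y + length (b ∷ W)   ∎
  where open ≤-Reasoning

inv-≤-length : ∀ {n} (W : Word n) → inv (prod W) ≤ length W
inv-≤-length {n} W = subst (λ m → inv (prod W) ≤ m + length W) (inv-e {n}) (inv-prod-≤ e W)

Asc : ∀ {n} → S n → Word n → Set
Asc y []       = ⊤
Asc y (b ∷ bs) = Ascent y b × Asc (y · s b) bs

Asc-cong : ∀ {n} {y y′ : S n} → y ≈ y′ → ∀ W → Asc y W → Asc y′ W
Asc-cong y≈y′ []      _               = tt
Asc-cong y≈y′ (b ∷ W) (ascent , rest) =
  subst₂ _<_ (cong toℕ (y≈y′ _)) (cong toℕ (y≈y′ _)) ascent , Asc-cong (λ k → y≈y′ _) W rest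

Asc⇒inv-additive : ∀ {n} (y : S n) W → Asc y W → inv (y · prod W) ≡ inv y + length W
Asc⇒inv-additive y []      _               = sym (+-identityʳ _)
Asc⇒inv-additive y (b ∷ W) (ascent , rest) = begin
  inv ((y · s b) · prod W) ≡⟨ Asc⇒inv-additive (y · s b) W rest ⟩
  inv (y · s b) + length W ≡⟨ cong (_+ length W) (inv-ascent y b ascent) ⟩
  suc (inv y) + length W   ≡⟨ sym (+-suc (inv y) (length W)) ⟩
  inv y + length (b ∷ W)   ∎
  where open ≡-Reasoning

inv-additive⇒Asc : ∀ {n} (y : S n) W → inv (y · prod W) ≡ inv y + length W → Asc y W
inv-additive⇒Asc y []      _        = tt
inv-additive⇒Asc y (b ∷ W) additive with ascent-or-descent y b
... | inj₁ ascent  = ascent , inv-additive⇒Asc (y · s b) W (begin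
  inv ((y · s b) · prod W) ≡⟨ additive ⟩
  inv y + suc (length W)   ≡⟨ +-suc (inv y) (length W) ⟩
  suc (inv y) + length W   ≡⟨ cong (_+ length W) (sym (inv-ascent y b ascent)) ⟩
  inv (y · s b) + length W ∎)
  where open ≡-Reasoning
... | inj₂ descent = ⊥-elim (<-irrefl refl (begin-strict
  inv y + suc (length W)   ≡⟨ sym additive ⟩
  inv ((y · s b) · prod W) ≤⟨ inv-prod-≤ (y · s b) W ⟩
  inv (y · s b) + length W <⟨ +-monoˡ-< (length W) (≤-reflexive (sym (inv-descent y b descent))) ⟩
  inv y + length W         <⟨ +-monoʳ-< (inv y) (n<1+n _) ⟩
  inv y + suc (length W)   ∎))
  where open ≤-Reasoning

-- A map on Fin (suc n) increasing on adjacent points is the identity: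
-- it is bounded below by the identity (induction upwards from 0) and
-- above by it (induction downwards from n).
module _ {n : ℕ} (g : Fin (suc n) → Fin (suc n))
         (increasing : ∀ (b : Fin n) → toℕ (g (inject₁ b)) < toℕ (g (fsuc b))) where

  id-≤ : ∀ m k → toℕ k ≡ m → m ≤ toℕ (g k)
  id-≤ zero    k        _  = z≤n
  id-≤ (suc m) (fsuc j) eq =
    ≤-trans (s≤s (id-≤ m (inject₁ j) (trans (FP.toℕ-inject₁ j) (suc-injective eq)))) (increasing j)

  ≤-id : ∀ d k → toℕ k + d ≡ n → toℕ (g k) ≤ toℕ k
  ≤-id zero    k k+0≡n = m<1+n⇒m≤n (subst (λ m → toℕ (g k) < suc m) n≡k (FP.toℕ<n (g k)))
    where
    n≡k : n ≡ toℕ k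
    n≡k = trans (sym k+0≡n) (+-identityʳ _)
  ≤-id (suc d) k k+d+1≡n = m<1+n⇒m≤n (begin-strict
      toℕ (g k)               ≡⟨ cong (λ i → toℕ (g i)) (sym (FP.inject₁-lower₁ k n≢k)) ⟩
      toℕ (g (inject₁ b))     <⟨ increasing b ⟩
      toℕ (g (fsuc b))        ≤⟨ ≤-id d (fsuc b) b+1+d≡n ⟩
      suc (toℕ b)             ≡⟨ cong suc b≡k ⟩
      suc (toℕ k)             ∎)
    where
    open ≤-Reasoning
    n≢k : n ≢ toℕ k
    n≢k n≡k = <-irrefl (sym n≡k) (subst (toℕ k <_) k+d+1≡n (m<m+n (toℕ k) (s≤s z≤n)))
    b : Fin n
    b = lower₁ k n≢k
    b≡k : toℕ b ≡ toℕ k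
    b≡k = FP.toℕ-lower₁ k n≢k
    b+1+d≡n : toℕ (fsuc b) + d ≡ n
    b+1+d≡n = trans (cong (λ i → suc i + d) b≡k) (trans (sym (+-suc (toℕ k) d)) k+d+1≡n)

  increasing⇒id : ∀ k → g k ≡ k
  increasing⇒id k = FP.toℕ-injective (≤-antisym
    (≤-id (n ∸ toℕ k) k (m+[n∸m]≡n (m<1+n⇒m≤n (FP.toℕ<n k))))
    (id-≤ (toℕ k) k refl))

prod-++ : ∀ {n} (W V : Word n) k → prod (W ++ V) ⟨$⟩ʳ k ≡ prod W ⟨$⟩ʳ (prod V ⟨$⟩ʳ k)
prod-++ []      V k = refl
prod-++ (b ∷ W) V k = cong (s b ⟨$⟩ʳ_) (prod-++ W V k)

prod-∷ʳ : ∀ {n} (W : Word n) b → prod (W ∷ʳ b) ≈ (prod W · s b)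
prod-∷ʳ W b = prod-++ W (b ∷ [])

no-descent⇒id : ∀ {n} (y : S n) → ¬ (∃[ b ] Descent y b) → y ≈ e
no-descent⇒id y no-descent = increasing⇒id (y ⟨$⟩ʳ_) ascent
  where
  ascent : ∀ b → Ascent y b
  ascent b with ascent-or-descent y b
  ... | inj₁ asc     = asc
  ... | inj₂ descent = ⊥-elim (no-descent (b , descent))

-- Bubble sort: every permutation y is a product of inv(y) simple
-- transpositions (remove descents one at a time).
bubbleSort : ∀ {n} m (y : S n) → inv y ≡ m → Σ (Word n) λ W → (prod W ≈ y) × (length W ≡ m)
bubbleSort m y inv≡m with FP.any? (λ b → val y (fsuc b) <? val y (inject₁ b))
bubbleSort zero y inv≡0 | yes (b , descent) =
  ⊥-elim (0≢1+n (trans (sym inv≡0) (inv-descent y b descent)))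
bubbleSort (suc m) y inv≡m | yes (b , descent)
  with bubbleSort m (y · s b) (suc-injective (trans (sym (inv-descent y b descent)) inv≡m))
... | W , W≈ys , len =
  W ∷ʳ b ,
  (λ k → trans (prod-∷ʳ W b k) (trans (W≈ys (s b ⟨$⟩ʳ k)) (cong (y ⟨$⟩ʳ_) (s-involutive b k)))) ,
  trans (LP.length-++ W) (trans (+-comm (length W) 1) (cong suc len))
bubbleSort {n} m y inv≡m | no no-descent =
  [] , (λ k → sym (y≈e k)) , trans (sym (trans (inv-cong {y = y} {y′ = e} y≈e) (inv-e {n}))) inv≡m
  where
  y≈e : y ≈ e
  y≈e = no-descent⇒id y no-descent

length≡inv : ∀ {n} {y : S n} {k} → HasLength y k → k ≡ inv y
length≡inv {y = y} {k} ((W , W≈y , lenW) , minimal) with bubbleSort (inv y) y refl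
... | V , V≈y , lenV = ≤-antisym (≤-trans (minimal V V≈y) (≤-reflexive lenV)) (begin
  inv y        ≡⟨ sym (inv-cong {y = prod W} {y′ = y} W≈y) ⟩
  inv (prod W) ≤⟨ inv-≤-length W ⟩
  length W     ≡⟨ lenW ⟩
  k            ∎)
  where open ≤-Reasoning

Reduced⇒inv : ∀ {n} (W : Word n) → Reduced W → inv (prod W) ≡ length W
Reduced⇒inv W reduced with bubbleSort (inv (prod W)) (prod W) refl
... | V , V≈W , lenV = ≤-antisym (inv-≤-length W) (≤-trans (reduced V V≈W) (≤-reflexive lenV))

Reduced⇒Asc : ∀ {n} (W : Word n) → Reduced W → Asc e W
Reduced⇒Asc {n} W reduced =
  inv-additive⇒Asc e W (trans (Reduced⇒inv W reduced) (cong (_+ length W) (sym (inv-e {n}))))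

Asc⇒Reduced : ∀ {n} (W : Word n) → Asc e W → Reduced W
Asc⇒Reduced {n} W ascending W′ W′≈W = begin
  length W      ≡⟨ sym (trans (Asc⇒inv-additive e W ascending) (cong (_+ length W) (inv-e {n}))) ⟩
  inv (prod W)  ≡⟨ sym (inv-cong {y = prod W′} {y′ = prod W} W′≈W) ⟩
  inv (prod W′) ≤⟨ inv-≤-length W′ ⟩
  length W′     ∎
  where open ≤-Reasoning

Reduced-tail : ∀ {n} b (W : Word n) → Reduced (b ∷ W) → Reduced W
Reduced-tail b W reduced W′ W′≈W = ≤-pred (reduced (b ∷ W′) (λ k → cong (s b ⟨$⟩ʳ_) (W′≈W k)))

≤B⇒inv-≤ : ∀ {n} {u v : S n} → u ≤B v → inv u ≤ inv v
≤B⇒inv-≤ {u = u} {v} (≤B-refl u≈v) = ≤-reflexive (inv-cong {y = u} {y′ = v} u≈v)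
≤B⇒inv-≤ {v = v} (≤B-step {x = x} a b _ u≤x (k , k′ , len-x , len-xt , k<k′) xt≈v) = begin
  _                       ≤⟨ ≤B⇒inv-≤ u≤x ⟩
  inv x                   ≡⟨ sym (length≡inv {y = x} len-x) ⟩
  k                       ≤⟨ <⇒≤ k<k′ ⟩
  k′                      ≡⟨ length≡inv {y = x · transpose a b} len-xt ⟩
  inv (x · transpose a b) ≡⟨ inv-cong {y = x · transpose a b} {y′ = v} xt≈v ⟩
  inv v                   ∎
  where open ≤-Reasoning

<B⇒ascent : ∀ {n} (x : S n) b → x <B (x · s b) → Ascent x b
<B⇒ascent x b (x≤xs , _) with ascent-or-descent x b
... | inj₁ ascent  = ascent
... | inj₂ descent = ⊥-elim (<⇒≱ (≤-reflexive (sym (inv-descent x b descent))) (≤B⇒inv-≤ x≤xs))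

-- This is the classical
-- inversion-set criterion for ℓ(y z) = ℓ(y) + ℓ(z) (Asc⇒KeepsAt, KeepsAt⇒Asc).
KeepsAt : ∀ {n} → S n → S n → Set
KeepsAt y z =
  ∀ k l → toℕ k < toℕ l → val z l < val z k → val y (z ⟨$⟩ʳ l) < val y (z ⟨$⟩ʳ k)

KeepsAt-cong : ∀ {n} (y z z′ : S n) → z ≈ z′ → KeepsAt y z → KeepsAt y z′
KeepsAt-cong y z z′ z≈z′ keeps k l k<l inverted =
  subst₂ (λ a c → val y a < val y c) (z≈z′ l) (z≈z′ k)
    (keeps k l k<l (subst₂ _<_ (sym (cong toℕ (z≈z′ l))) (sym (cong toℕ (z≈z′ k))) inverted))

module _ {n : ℕ} (y z : S n) (b : Fin n) where

  -- z s_b has the inverted position pairs of z, moved by s_b, plus the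
  -- pair (b, b+1) when b is an ascent of z.  Hence y keeps the inversions
  -- of z s_b iff it keeps those of z and the pair z(b) < z(b+1).
  KeepsAt-extend : KeepsAt y z → Ascent (y · z) b → KeepsAt y (z · s b)
  KeepsAt-extend keeps new k l k<l inverted with (k FP.≟ inject₁ b) ×-dec (l FP.≟ fsuc b)
  ... | yes (refl , refl) rewrite s-b b | s-b+1 b = new
  ... | no not-pair       = keeps _ _ (s-monotone b k<l not-pair) inverted

  KeepsAt-restrict : KeepsAt y (z · s b) → Ascent z b →
                     KeepsAt y z × Ascent (y · z) b
  KeepsAt-restrict keeps z-ascent = old , new
    where
    new : Ascent (y · z) b
    new = subst₂ (λ a c → val y (z ⟨$⟩ʳ a) < val y (z ⟨$⟩ʳ c)) (s-b+1 b) (s-b b)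
      (keeps (inject₁ b) (fsuc b) (b<b+1 b)
        (subst₂ (λ a c → val z a < val z c) (sym (s-b+1 b)) (sym (s-b b)) z-ascent))
    old : KeepsAt y z
    old k l k<l inverted =
      subst₂ (λ a c → val y (z ⟨$⟩ʳ a) < val y (z ⟨$⟩ʳ c)) (s-involutive b l) (s-involutive b k)
      (keeps (s b ⟨$⟩ʳ k) (s b ⟨$⟩ʳ l) (s-monotone b k<l not-pair)
        (subst₂ (λ a c → val z a < val z c) (sym (s-involutive b l)) (sym (s-involutive b k)) inverted))
      where
      not-pair : ¬ (k ≡ inject₁ b × l ≡ fsuc b)
      not-pair (refl , refl) = <-asym z-ascent inverted

Asc-∷ʳ⇒ : ∀ {n} (y : S n) Z b → Asc y (Z ∷ʳ b) → Asc y Z × Ascent (y · prod Z) b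
Asc-∷ʳ⇒ y []      b (ascent , _)    = tt , ascent
Asc-∷ʳ⇒ y (c ∷ Z) b (ascent , rest) = map₁ (ascent ,_) (Asc-∷ʳ⇒ (y · s c) Z b rest)

Asc-∷ʳ⇐ : ∀ {n} (y : S n) Z b → Asc y Z → Ascent (y · prod Z) b → Asc y (Z ∷ʳ b)
Asc-∷ʳ⇐ y []      b _               ascent-b = ascent-b , tt
Asc-∷ʳ⇐ y (c ∷ Z) b (ascent , rest) ascent-b = ascent , Asc-∷ʳ⇐ (y · s c) Z b rest ascent-b

Asc⇒KeepsAt : ∀ {n} (y : S n) Z → Asc y Z → KeepsAt y (prod Z)
Asc⇒KeepsAt y Z = go Z (reverseView Z)
  where
  go : ∀ Z → Reverse Z → Asc y Z → KeepsAt y (prod Z)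
  go .[] [] _ k l k<l inverted = ⊥-elim (<-asym k<l inverted)
  go .(Z ∷ʳ b) (Z ∶ rev ∶ʳ b) ascending with Asc-∷ʳ⇒ y Z b ascending
  ... | ascending-Z , ascent-b =
    KeepsAt-cong y (prod Z · s b) (prod (Z ∷ʳ b)) (λ k → sym (prod-∷ʳ Z b k))
      (KeepsAt-extend y (prod Z) b (go Z rev ascending-Z) ascent-b)

KeepsAt⇒Asc : ∀ {n} (y : S n) Z → Asc e Z → KeepsAt y (prod Z) → Asc y Z
KeepsAt⇒Asc y Z = go Z (reverseView Z)
  where
  go : ∀ Z → Reverse Z → Asc e Z → KeepsAt y (prod Z) → Asc y Z
  go .[] [] _ _ = tt
  go .(Z ∷ʳ b) (Z ∶ rev ∶ʳ b) reduced keeps with Asc-∷ʳ⇒ e Z b reduced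
  ... | reduced-Z , z-ascent
    with KeepsAt-restrict y (prod Z) b
           (KeepsAt-cong y (prod (Z ∷ʳ b)) (prod Z · s b) (prod-∷ʳ Z b) keeps) z-ascent
  ... | keeps-Z , new = Asc-∷ʳ⇐ y Z b (go Z rev reduced-Z keeps-Z) new

Inverted : ∀ {n} → S n → Fin (suc n) → Fin (suc n) → Set
Inverted z p q = toℕ p < toℕ q × toℕ (z ⟨$⟩ˡ q) < toℕ (z ⟨$⟩ˡ p)

Keeps : ∀ {n} → S n → S n → Set
Keeps y z = ∀ {p q} → Inverted z p q → val y p < val y q

-- Translation between the two phrasings: positions k < l of z carry the
-- values z(l) < z(k), and values p < q sit at positions z⁻¹(q) < z⁻¹(p).
Asc⇒Keeps : ∀ {n} (y : S n) Z → Asc y Z → Keeps y (prod Z)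
Asc⇒Keeps y Z ascending {p} {q} (p<q , zq<zp) =
  subst₂ (λ a c → val y a < val y c) (P.inverseʳ z) (P.inverseʳ z)
    (Asc⇒KeepsAt y Z ascending (z ⟨$⟩ˡ q) (z ⟨$⟩ˡ p) zq<zp
      (subst₂ _<_ (sym (cong toℕ (P.inverseʳ z))) (sym (cong toℕ (P.inverseʳ z))) p<q))
  where z = prod Z

Keeps⇒Asc : ∀ {n} (y : S n) Z → Asc e Z → Keeps y (prod Z) → Asc y Z
Keeps⇒Asc y Z reduced keeps = KeepsAt⇒Asc y Z reduced λ k l k<l inverted →
  keeps (inverted , subst₂ _<_ (sym (cong toℕ (P.inverseˡ z))) (sym (cong toℕ (P.inverseˡ z))) k<l)
  where z = prod Z

module _ {n : ℕ} (x z : S n) (i : Fin n)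
         (x-keeps : Keeps x z) (s-keeps : Keeps (s i) z)
         (x-ascent : Ascent x i) where

  private
    pos : Fin (suc n) → ℕ
    pos q = toℕ (z ⟨$⟩ˡ q)

  -- The values i < i+1 are not inverted by z, as s_i does not keep them.
  pos-i<pos-i+1 : pos (inject₁ i) < pos (fsuc i)
  pos-i<pos-i+1 with <-cmp (pos (inject₁ i)) (pos (fsuc i))
  ... | tri< i-before-i+1 _ _ = i-before-i+1
  ... | tri≈ _ eq _ = ⊥-elim (<-irrefl (cong toℕ i≡i+1) (b<b+1 i))
    where
    i≡i+1 : inject₁ i ≡ fsuc i
    i≡i+1 = trans (sym (P.inverseʳ z)) (trans (cong (z ⟨$⟩ʳ_) (FP.toℕ-injective eq)) (P.inverseʳ z))
  ... | tri> _ _ i+1-before-i = ⊥-elim (<-asym (b<b+1 i)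
          (subst₂ _<_ (cong toℕ (s-b i)) (cong toℕ (s-b+1 i)) (s-keeps (b<b+1 i , i+1-before-i))))

  -- Case analysis on whether p and q are i, i+1 or fixed by s_i; the
  -- mixed cases follow from the inverted pair (i+1, q) resp. (p, i), or
  -- from chaining with the ascent x(i) < x(i+1).
  xs-keeps : Keeps (x · s i) z
  xs-keeps {p} {q} (p<q , q-before-p) with swapView i p | swapView i q
  ... | at-b   | at-b   = ⊥-elim (<-irrefl refl p<q)
  ... | at-b   | at-b+1 = ⊥-elim (<-asym pos-i<pos-i+1 q-before-p)
  ... | at-b   | fixed q≢i q≢i+1 rewrite s-b i | s-fixed i q≢i q≢i+1 =
        x-keeps (above-b+1 i p<q q≢i+1 , <-trans q-before-p pos-i<pos-i+1)
  ... | at-b+1 | at-b   = ⊥-elim (<-asym p<q (b<b+1 i))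
  ... | at-b+1 | at-b+1 = ⊥-elim (<-irrefl refl p<q)
  ... | at-b+1 | fixed q≢i q≢i+1 rewrite s-b+1 i | s-fixed i q≢i q≢i+1 =
        <-trans x-ascent (x-keeps (p<q , q-before-p))
  ... | fixed p≢i p≢i+1 | at-b rewrite s-fixed i p≢i p≢i+1 | s-b i =
        <-trans (x-keeps (p<q , q-before-p)) x-ascent
  ... | fixed p≢i p≢i+1 | at-b+1 rewrite s-fixed i p≢i p≢i+1 | s-b+1 i =
        x-keeps (below-b i p<q p≢i , <-trans pos-i<pos-i+1 q-before-p)
  ... | fixed p≢i p≢i+1 | fixed q≢i q≢i+1 rewrite s-fixed i p≢i p≢i+1 | s-fixed i q≢i q≢i+1 =
        x-keeps (p<q , q-before-p)

Asc-shift : ∀ {n} (x : S n) i Z → Asc e Z → Asc x Z → Asc (s i) Z →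
            Ascent x i → Asc (x · s i) Z
Asc-shift x i Z reduced ascending-x ascending-s x-ascent =
  Keeps⇒Asc (x · s i) Z reduced
    (xs-keeps x (prod Z) i (Asc⇒Keeps x Z ascending-x) (Asc⇒Keeps (s i) Z ascending-s) x-ascent)

-- At a letter in J this is the PDS
-- condition u_(j-1) < u_(j-1) s_{i_j}; at a letter not in J we have
-- u_(j) = u_(j-1), and the remaining word, being a tail of a reduced word
-- starting with s_{i_j}, also ascends from s_{i_j}, so Asc-shift applies.
PDS⇒Asc : ∀ {n} {u : S n} x ws J → PDS-from x ws J u → Reduced ws → Asc x ws
PDS⇒Asc x []       []          _                  _       = tt
PDS⇒Asc x []       (_ ∷ _)     ()                 _
PDS⇒Asc x (_ ∷ _)  []          ()                 _
PDS⇒Asc x (a ∷ ws) (true ∷ J)  (_ , x<xa , rest) reduced =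
  <B⇒ascent x a x<xa , PDS⇒Asc (x · s a) ws J rest (Reduced-tail a ws reduced)
PDS⇒Asc x (a ∷ ws) (false ∷ J) (_ , x<xa , rest) reduced =
  x-ascent ,
  Asc-shift x a ws (Reduced⇒Asc ws reduced-ws) (PDS⇒Asc x ws J rest reduced-ws) ascending-s x-ascent
  where
  reduced-ws : Reduced ws
  reduced-ws = Reduced-tail a ws reduced
  x-ascent : Ascent x a
  x-ascent = <B⇒ascent x a x<xa
  ascending-s : Asc (s a) ws
  ascending-s = Asc-cong {y = e · s a} {y′ = s a} (λ _ → refl) ws
                         (proj₂ (Reduced⇒Asc (a ∷ ws) reduced))

PDS-length : ∀ {n} {u : S n} x (ws : Word n) J → PDS-from x ws J u → length ws ≡ length J
PDS-length x []       []      _                = refl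
PDS-length x []       (_ ∷ _) ()
PDS-length x (_ ∷ _)  []      ()
PDS-length x (a ∷ ws) (b ∷ J) (_ , _ , rest)  = cong suc (PDS-length _ ws J rest)

addRightmost-leftover : ∀ r J → proj₂ (addRightmost′ r J) ≡ r ∸ countFalse J
addRightmost-leftover r []          = refl
addRightmost-leftover r (true ∷ J)  = addRightmost-leftover r J
addRightmost-leftover r (false ∷ J) with addRightmost′ r J | addRightmost-leftover r J
... | _ , zero  | leftover = trans (cong pred leftover) (pred[m∸n]≡m∸[1+n] r (countFalse J))
... | _ , suc k | leftover = trans (cong pred leftover) (pred[m∸n]≡m∸[1+n] r (countFalse J))

addRightmost-skip : ∀ r J → r ≤ countFalse J → addRightmost r (false ∷ J) ≡ false ∷ addRightmost r J
addRightmost-skip r J r≤d with addRightmost′ r J | addRightmost-leftover r J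
... | _ , zero  | _        = refl
... | _ , suc k | leftover = ⊥-elim (0≢1+n (trans (sym (m≤n⇒m∸n≡0 r≤d)) (sym leftover)))

addRightmost-take : ∀ r J → countFalse J < r → addRightmost r (false ∷ J) ≡ true ∷ addRightmost r J
addRightmost-take r J d<r with addRightmost′ r J | addRightmost-leftover r J
... | _ , zero  | leftover = ⊥-elim (<⇒≱ d<r (m∸n≡0⇒m≤n (sym leftover)))
... | _ , suc k | _        = refl

addRightmost-saturated : ∀ r J → countFalse J ≤ r → addRightmost r J ≡ replicate (length J) true
addRightmost-saturated r []          _   = refl
addRightmost-saturated r (true ∷ J)  d≤r = cong (true ∷_) (addRightmost-saturated r J d≤r)
addRightmost-saturated r (false ∷ J) d≤r rewrite addRightmost-take r J d≤r =
  cong (true ∷_) (addRightmost-saturated r J (≤-trans (n≤1+n _) d≤r))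

select-all : ∀ {A : Set} (xs : List A) (J : List Bool) → length xs ≡ length J →
             select xs (replicate (length J) true) ≡ xs
select-all []       []      _   = refl
select-all (x ∷ xs) (_ ∷ J) len = cong (x ∷_) (select-all xs J (suc-injective len))

-- Letters of J are ascents by the PDS
-- condition; once the first added position outside J is reached, all
-- later positions are added too, and the whole remaining word ascends
-- by PDS⇒Asc.
selection-Asc : ∀ {n} {u : S n} x ws J → PDS-from x ws J u → Reduced ws →
                ∀ r → r ≤ countFalse J → Asc x (select ws (addRightmost r J))
selection-Asc x []       []          _                  _       r _   = tt
selection-Asc x []       (_ ∷ _)     ()                 _       r _
selection-Asc x (_ ∷ _)  []          ()                 _       r _
selection-Asc x (a ∷ ws) (true ∷ J)  (_ , x<xa , rest) reduced r r≤d =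
  <B⇒ascent x a x<xa , selection-Asc (x · s a) ws J rest (Reduced-tail a ws reduced) r r≤d
selection-Asc x (a ∷ ws) (false ∷ J) pds@(_ , _ , rest) reduced r _ with r ≤? countFalse J
... | yes r≤d rewrite addRightmost-skip r J r≤d =
  selection-Asc x ws J rest (Reduced-tail a ws reduced) r r≤d
... | no r≰d rewrite addRightmost-take r J (≰⇒> r≰d)
                   | addRightmost-saturated r J (<⇒≤ (≰⇒> r≰d))
                   | select-all ws J (PDS-length x ws J rest) =
  PDS⇒Asc x (a ∷ ws) (false ∷ J) pds reduced

_⊑_ : List Bool → List Bool → Set
[]          ⊑ []         = ⊤
(true ∷ J)  ⊑ (true ∷ K) = J ⊑ K
(false ∷ J) ⊑ (_ ∷ K)    = J ⊑ K
_           ⊑ _          = ⊥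

addRightmost-⊒ : ∀ r J → J ⊑ addRightmost r J
addRightmost-⊒ r []          = tt
addRightmost-⊒ r (true ∷ J)  = addRightmost-⊒ r J
addRightmost-⊒ r (false ∷ J) with addRightmost′ r J | addRightmost-⊒ r J
... | _ , zero  | J⊑K = J⊑K
... | _ , suc _ | J⊑K = J⊑K

-- Restricting a PDS to a larger set of positions K gives a PDS in the
-- subword: the letters outside K are outside J, so they never change the
-- running product, and the conditions at the remaining letters are unchanged.
PDS-restrict : ∀ {n} {u : S n} x ws J K → PDS-from x ws J u → J ⊑ K →
               PDS-from x (select ws K) (select J K) u
PDS-restrict x []       []          []          pds _   = pds
PDS-restrict x []       (_ ∷ _)     _           ()  _
PDS-restrict x (_ ∷ _)  []          _           ()  _
PDS-restrict x (a ∷ ws) (true ∷ J)  (true ∷ K)  (c₁ , c₂ , rest) J⊑K =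
  c₁ , c₂ , PDS-restrict (x · s a) ws J K rest J⊑K
PDS-restrict x (a ∷ ws) (false ∷ J) (true ∷ K)  (c₁ , c₂ , rest) J⊑K =
  c₁ , c₂ , PDS-restrict x ws J K rest J⊑K
PDS-restrict x (a ∷ ws) (false ∷ J) (false ∷ K) (_ , _ , rest)   J⊑K =
  PDS-restrict x ws J K rest J⊑K

-- Proposition 2.10.  The subword v of w at the positions of J and of the
-- r rightmost positions outside J ascends from the identity, hence is
-- reduced, and J restricts to the PDS for u in v.
proposition2p10 : (n : ℕ) (ws : Word n) (u : S n) (J : List Bool) →
    Reduced ws → u ≤B prod ws → IsPDS ws J u →
    (r : ℕ) → r ≤ countFalse J →
    Reduced (select ws (addRightmost r J))
      × IsPDS (select ws (addRightmost r J)) (select J (addRightmost r J)) u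
proposition2p10 n ws u J reduced _ pds r r≤d =
  Asc⇒Reduced (select ws (addRightmost r J)) (selection-Asc e ws J pds reduced r r≤d) ,
  PDS-restrict e ws J (addRightmost r J) pds (addRightmost-⊒ r J)
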